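{- Let $T(\mathbf{Y},\mathbf{Y}')$ be a conjunction of $l$ discrete linear inequalities $P_j(\mathbf{Y})+Q_j(\mathbf{Y}')>c_j$ ($1\le j\le l$), where $\mathbf{Y}=(y_1,\dots,y_n)$ and $\mathbf{Y}'=(y_1',\dots,y_n')$ range over $\mathbb{Z}^n$, each $P_j,Q_j$ is a linear combination with integer coefficients and $c_j\in\mathbb{Z}$. Let $\mathcal{M}$ be a mode vector on the variables $\mathbf{Y}$ and the terms $P_j,Q_j$ ($1\le j\le l$). Then it is decidable whether $T$ has a monotonic (of mode $\mathcal{M}$) and strong $\omega$-chain.
   Context: An $\omega$-chain of $T$ is a sequence $\mathbf{V}^0,\mathbf{V}^1,\dots$ in $\mathbb{Z}^n$ with $T(\mathbf{V}^k,\mathbf{V}^{k+1})$ for all $k\ge0$; it is strong if $T(\mathbf{V}^{k_1},\mathbf{V}^{k_2})$ for all $0\le k_1<k_2$. For a linear combination $f$ of $\mathbf{Y}$ (a term $Q_j$ in primed variables is treated as the same linear combination of unprimed variables) and a sequence $(\mathbf{V}^k)$: $f$ is increasing/decreasing/flat if $f(\mathbf{V}^k)<f(\mathbf{V}^{k+1})$ / $>$ / $=$ for all $k$; bounded increasing (decreasing) if increasing (decreasing) and bounded above (below) strictly by some $b$; unbounded increasing (decreasing) if increasing (decreasing) but not bounded. The modes are: unbounded increasing, unbounded decreasing, flat, bounded increasing, bounded decreasing. A mode vector assigns a mode to each variable and listed term; a chain is monotonic of mode $\mathcal{M}$ if each variable and listed term has on the chain the mode assigned by $\mathcal{M}$.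 -}

module Defs where

open import Data.Nat using (ℕ; suc) renaming (_<_ to _<ℕ_)
open import Data.Integer using (ℤ; _+_; _*_; _<_; _>_; 0ℤ)
open import Data.Fin using (Fin)
open import Data.Vec using (Vec; foldr; zipWith; lookup)
open import Data.Product using (∃; _×_)
open import Relation.Nullary using (¬_)
open import Relation.Binary.PropositionalEquality using (_≡_)

Point : ℕ → Set
Point n = Vec ℤ n

LinComb : ℕ → Set
LinComb n = Vec ℤ n

eval : ∀ {n} → LinComb n → Point n → ℤ
eval a y = foldr (λ _ → ℤ) _+_ 0ℤ (zipWith _*_ a y)

record Ineq (n : ℕ) : Set where
  constructor ineq
  field
    P : LinComb n
    Q : LinComb n
    c : ℤ
open Ineq public

System : ℕ → ℕ → Set
System n l = Fin l → Ineq n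

Holds : ∀ {n l} → System n l → Point n → Point n → Set
Holds T Y Y' = ∀ j → eval (P (T j)) Y + eval (Q (T j)) Y' > c (T j)

Sequence : ℕ → Set
Sequence n = ℕ → Point n

IsOmegaChain : ∀ {n l} → System n l → Sequence n → Set
IsOmegaChain T V = ∀ k → Holds T (V k) (V (suc k))

IsStrong : ∀ {n l} → System n l → Sequence n → Set
IsStrong T V = ∀ k₁ k₂ → k₁ <ℕ k₂ → Holds T (V k₁) (V k₂)

data Mode : Set where
  unboundedIncreasing unboundedDecreasing flat boundedIncreasing boundedDecreasing : Mode

Increasing Decreasing Flat BoundedAbove BoundedBelow : (ℕ → ℤ) → Set
Increasing s = ∀ k → s k < s (suc k)
Decreasing s = ∀ k → s k > s (suc k)
Flat s = ∀ k → s k ≡ s (suc k)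
BoundedAbove s = ∃ λ b → ∀ k → s k < b
BoundedBelow s = ∃ λ b → ∀ k → s k > b

HasMode : (ℕ → ℤ) → Mode → Set
HasMode s unboundedIncreasing = Increasing s × ¬ BoundedAbove s
HasMode s unboundedDecreasing = Decreasing s × ¬ BoundedBelow s
HasMode s flat = Flat s
HasMode s boundedIncreasing = Increasing s × BoundedAbove s
HasMode s boundedDecreasing = Decreasing s × BoundedBelow s

record ModeVector (n l : ℕ) : Set where
  constructor modeVector
  field
    varMode : Fin n → Mode
    PMode : Fin l → Mode
    QMode : Fin l → Mode
open ModeVector public

-- Monotonic of mode M (Q_j evaluated as the same combination of unprimed variables).
IsMonotonic : ∀ {n l} → System n l → ModeVector n l → Sequence n → Set
IsMonotonic T M V =
  (∀ i → HasMode (λ k → lookup (V k) i) (varMode M i)) ×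
  (∀ j → HasMode (λ k → eval (P (T j)) (V k)) (PMode M j)) ×
  (∀ j → HasMode (λ k → eval (Q (T j)) (V k)) (QMode M j))

HasMonotonicStrongChain : ∀ {n l} → System n l → ModeVector n l → Set
HasMonotonicStrongChain T M =
  ∃ λ V → IsOmegaChain T V × IsStrong T V × IsMonotonic T M V

{-# OPTIONS --safe #-}
-- A chain of the required kind can be taken along a ray: if V⁰ and V¹ satisfy T and, for every
-- variable and listed term f, the difference f(V¹) − f(V⁰) has the sign prescribed by its mode
-- (positive, negative or zero), then Vᵏ = V⁰ + (2 + R)ᵏ (V¹ − V⁰) is monotonic of mode M.  It is
-- moreover strong provided no Q_j decreases and no P_j decreases while its Q_j is flat: the growth
-- of Q_j at the later index then outweighs any decrease of P_j, once R bounds every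
-- |P_j(V¹) − P_j(V⁰)|.  Conversely, the first two points of any monotonic strong chain have these
-- signs, bounded modes never occur (a strictly monotone integer sequence is unbounded), and
-- strongness rules out the two forbidden pairs of modes.  Hence the question is whether a system of
-- linear inequalities in (V⁰, V¹) has an integer solution, which Cooper's quantifier elimination
-- decides.
module Submission where

open import Defs
open import Data.Nat using (ℕ)
open import Relation.Nullary using (Dec)

open import Data.Nat as ℕ using (zero; suc; z≤n; s≤s; z<s; NonZero; _^_)
import Data.Nat.Properties as ℕP
open import Data.Nat.Divisibility using () renaming (_∣_ to _∣ℕ_)
open import Data.Nat.Induction using (<-wellFounded)
open import Data.Nat.ListAction using (product)
open import Data.Nat.ListAction.Properties using (∈⇒∣product; product≢0)
open import Data.Integer as ℤ
  using (ℤ; +_; +[1+_]; -[1+_]; +0; _+_; _*_; _-_; -_; _≤_; _<_; _>_; 0ℤ; 1ℤ; ∣_∣; +≤+; -≤+)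
import Data.Integer.Properties as ℤP
open import Data.Integer.Divisibility.Signed as Div using (_∣_; divides)
open import Data.Integer.Tactic.RingSolver using (solve-∀)
open import Data.Fin as Fin using (Fin; toℕ; fromℕ<)
import Data.Fin.Properties as FinP
open import Data.Vec as Vec using (Vec; []; _∷_; _++_; lookup; zipWith; replicate)
open import Data.Vec.Properties using (lookup-zipWith)
open import Data.List as List using (List; []; _∷_; mapMaybe)
open import Data.List.Extrema.Nat using (max; xs≤max)
open import Data.List.Relation.Unary.All as All using (All; []; _∷_)
import Data.List.Relation.Unary.All.Properties as All
open import Data.List.Relation.Unary.Any as Any using (Any; here)
import Data.List.Relation.Unary.Any.Properties as Any
open import Data.List.Membership.Propositional using (_∈_; find; lose)
open import Data.List.Membership.Propositional.Properties using (∈-map⁺)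
open import Data.Maybe using (Maybe; just; nothing)
import Data.Maybe.Relation.Unary.Any as Maybe
open import Data.Bool as Bool using (Bool; true; false)
open import Data.Product using (∃; ∃₂; _×_; _,_)
open import Data.Sum using (_⊎_; inj₁; inj₂)
open import Data.Empty using (⊥; ⊥-elim)
open import Function using (_∘_; _⇔_; mk⇔; Equivalence)
import Function.Properties.Equivalence as ⇔
open import Induction.WellFounded using (Acc; acc)
open import Relation.Unary using (Decidable)
open import Relation.Nullary using (yes; no; ¬_)
open import Relation.Nullary.Decidable as Dec using (_⊎-dec_; _×-dec_)
open import Relation.Binary.PropositionalEquality
  using (_≡_; refl; sym; trans; cong; cong₂; subst; subst₂; module ≡-Reasoning)

open Equivalence using (to; from)

i≤+∣i∣ : ∀ i → i ≤ + ∣ i ∣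
i≤+∣i∣ (+ n) = ℤP.≤-refl
i≤+∣i∣ -[1+ n ] = -≤+

-∣i∣≤i : ∀ i → - + ∣ i ∣ ≤ i
-∣i∣≤i +0 = ℤP.≤-refl
-∣i∣≤i +[1+ n ] = -≤+
-∣i∣≤i -[1+ n ] = ℤP.≤-refl

0<j-i : ∀ {i j} → i < j → 0ℤ < j - i
0<j-i {i} {j} i<j = subst (_< j - i) (ℤP.+-inverseʳ i) (ℤP.+-monoˡ-< (- i) i<j)

i-j<0 : ∀ {i j} → i < j → i - j < 0ℤ
i-j<0 {i} {j} i<j = subst (i - j <_) (ℤP.+-inverseʳ j) (ℤP.+-monoˡ-< (- j) i<j)

i-j<i : ∀ i {j} → 0ℤ < j → i - j < i
i-j<i i {j} 0<j = subst (i - j <_) (ℤP.+-identityʳ i) (ℤP.+-monoʳ-< i (ℤP.neg-mono-< 0<j))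

i<j+k⇒i-j<k : ∀ {i} j {k} → i < j + k → i - j < k
i<j+k⇒i-j<k {i} j {k} i<j+k = subst (i - j <_) (cancel j k) (ℤP.+-monoˡ-< (- j) i<j+k)
  where
  cancel : ∀ j k → j + k - j ≡ k
  cancel = solve-∀

zeros : ∀ {m} → Vec ℤ m
zeros = replicate _ 0ℤ

negate : ∀ {m} → Vec ℤ m → Vec ℤ m
negate = Vec.map (-_)

lincomb : ∀ {m} → ℤ → ℤ → Vec ℤ m → Vec ℤ m → Vec ℤ m
lincomb α β = zipWith (λ a b → α * a + β * b)

unit : ∀ {n} → Fin n → Vec ℤ n
unit Fin.zero = 1ℤ ∷ zeros
unit (Fin.suc i) = 0ℤ ∷ unit i

interpolate : ∀ {n} → ℤ → Point n → Point n → Point n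
interpolate t = zipWith (λ u v → u + t * (v - u))

eval-zeros : ∀ {m} (x : Vec ℤ m) → eval zeros x ≡ 0ℤ
eval-zeros [] = refl
eval-zeros (xᵢ ∷ x) = cong (λ e → 0ℤ * xᵢ + e) (eval-zeros x)

eval-negate : ∀ {m} (a x : Vec ℤ m) → eval (negate a) x ≡ - eval a x
eval-negate [] [] = refl
eval-negate (aᵢ ∷ a) (xᵢ ∷ x) =
  trans (cong (λ e → - aᵢ * xᵢ + e) (eval-negate a x)) (pull-out aᵢ xᵢ (eval a x))
  where
  pull-out : ∀ aᵢ xᵢ e → - aᵢ * xᵢ + - e ≡ - (aᵢ * xᵢ + e)
  pull-out = solve-∀

eval-lincomb : ∀ {m} α β (a b x : Vec ℤ m) → eval (lincomb α β a b) x ≡ α * eval a x + β * eval b x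
eval-lincomb α β [] [] [] = sym (vanish α β)
  where
  vanish : ∀ α β → α * 0ℤ + β * 0ℤ ≡ 0ℤ
  vanish = solve-∀
eval-lincomb α β (aᵢ ∷ a) (bᵢ ∷ b) (xᵢ ∷ x) =
  trans (cong (λ e → (α * aᵢ + β * bᵢ) * xᵢ + e) (eval-lincomb α β a b x))
        (distribute α β aᵢ bᵢ xᵢ (eval a x) (eval b x))
  where
  distribute : ∀ α β aᵢ bᵢ xᵢ e f →
    (α * aᵢ + β * bᵢ) * xᵢ + (α * e + β * f) ≡ α * (aᵢ * xᵢ + e) + β * (bᵢ * xᵢ + f)
  distribute = solve-∀

eval-unit : ∀ {n} (i : Fin n) x → eval (unit i) x ≡ lookup x i
eval-unit Fin.zero (xᵢ ∷ x) =
  trans (cong (λ e → 1ℤ * xᵢ + e) (eval-zeros x))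
        (trans (ℤP.+-identityʳ (1ℤ * xᵢ)) (ℤP.*-identityˡ xᵢ))
eval-unit (Fin.suc i) (xᵢ ∷ x) = trans (ℤP.+-identityˡ (eval (unit i) x)) (eval-unit i x)

eval-interpolate : ∀ {n} (f u v : Vec ℤ n) t →
  eval f (interpolate t u v) ≡ eval f u + t * (eval f v - eval f u)
eval-interpolate [] [] [] t = sym (trans (ℤP.+-identityˡ (t * 0ℤ)) (ℤP.*-zeroʳ t))
eval-interpolate (fᵢ ∷ f) (uᵢ ∷ u) (vᵢ ∷ v) t =
  trans (cong (λ e → fᵢ * (uᵢ + t * (vᵢ - uᵢ)) + e) (eval-interpolate f u v t))
        (collect fᵢ uᵢ vᵢ t (eval f u) (eval f v))
  where
  collect : ∀ fᵢ uᵢ vᵢ t U V →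
    fᵢ * (uᵢ + t * (vᵢ - uᵢ)) + (U + t * (V - U))
      ≡ fᵢ * uᵢ + U + t * (fᵢ * vᵢ + V - (fᵢ * uᵢ + U))
  collect = solve-∀

eval-++ : ∀ {m n} (a : Vec ℤ m) (b : Vec ℤ n) x y → eval (a ++ b) (x ++ y) ≡ eval a x + eval b y
eval-++ [] b [] y = sym (ℤP.+-identityˡ (eval b y))
eval-++ (aᵢ ∷ a) b (xᵢ ∷ x) y =
  trans (cong (λ e → aᵢ * xᵢ + e) (eval-++ a b x y)) (sym (ℤP.+-assoc (aᵢ * xᵢ) (eval a x) (eval b y)))

-- Integer feasibility of linear and divisibility constraints (Cooper's method)

data Kind : Set where
  ≥0 : Kind
  [1+_]∣ : ℕ → Kind

Satisfies : Kind → ℤ → Set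
Satisfies ≥0 v = 0ℤ ≤ v
Satisfies [1+ d ]∣ v = + suc d ∣ v

satisfies? : ∀ κ v → Dec (Satisfies κ v)
satisfies? ≥0 v = 0ℤ ℤ.≤? v
satisfies? [1+ d ]∣ v = + suc d Div.∣? v

record Atom (m : ℕ) : Set where
  constructor atom
  field
    kind : Kind
    coefficients : Vec ℤ m
    constant : ℤ

open Atom using (kind)

value : ∀ {m} → Vec ℤ m → Atom m → ℤ
value x (atom _ a c) = eval a x + c

Sat : ∀ {m} → Vec ℤ m → Atom m → Set
Sat x β = Satisfies (kind β) (value x β)

sat? : ∀ {m} (x : Vec ℤ m) β → Dec (Sat x β)
sat? x β = satisfies? (kind β) (value x β)

Solvable : ∀ {m} → List (Atom m) → Set
Solvable {m} cs = ∃ λ (x : Vec ℤ m) → All (Sat x) cs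

modulus : Kind → ℕ
modulus ≥0 = 1
modulus [1+ d ]∣ = suc d

period : ∀ {m} → List (Atom m) → ℕ
period cs = product (List.map (modulus ∘ kind) cs)

period≢0 : ∀ {m} (cs : List (Atom m)) → NonZero (period cs)
period≢0 cs = product≢0 (All.map⁺ (All.universal (modulus≢0 ∘ kind) cs))
  where
  modulus≢0 : ∀ κ → NonZero (modulus κ)
  modulus≢0 ≥0 = _
  modulus≢0 [1+ d ]∣ = _

modulus∣period : ∀ {m} {β : Atom m} {cs} → β ∈ cs → modulus (kind β) ∣ℕ period cs
modulus∣period β∈cs = ∈⇒∣product (∈-map⁺ (modulus ∘ kind) β∈cs)

value-shift : ∀ {m} x t (y : Vec ℤ m) κ b a r →
  value ((x - t) ∷ y) (atom κ (b ∷ a) r) ≡ value (x ∷ y) (atom κ (b ∷ a) r) - b * t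
value-shift x t y κ b a r = shift b x t (eval a y) r
  where
  shift : ∀ b x t A r → b * (x - t) + A + r ≡ b * x + A + r - b * t
  shift = solve-∀

lowerBound : ∀ {m} → ℕ → Vec ℤ m → ℤ → Atom (suc m)
lowerBound k a r = atom ≥0 (+[1+ k ] ∷ a) r

0≤head : ∀ {m} → Atom (suc m)
0≤head = lowerBound 0 zeros 0ℤ

value-0≤head : ∀ {m} x (y : Vec ℤ m) → value (x ∷ y) 0≤head ≡ x
value-0≤head x y = begin
  1ℤ * x + eval zeros y + 0ℤ  ≡⟨ cong (λ e → 1ℤ * x + e + 0ℤ) (eval-zeros y) ⟩
  1ℤ * x + 0ℤ + 0ℤ            ≡⟨ simplify x ⟩
  x                           ∎
  where
  open ≡-Reasoning
  simplify : ∀ x → 1ℤ * x + 0ℤ + 0ℤ ≡ x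
  simplify = solve-∀

reflect : ∀ {m} → Atom (suc m) → Atom (suc m)
reflect (atom κ (b ∷ a) r) = atom κ (- b ∷ a) r

sat-reflect⁺ : ∀ {m} x (y : Vec ℤ m) β → Sat (- x ∷ y) β → Sat (x ∷ y) (reflect β)
sat-reflect⁺ x y (atom κ (b ∷ a) r) = subst (Satisfies κ) (cong (λ z → z + eval a y + r) (mirror b x))
  where
  mirror : ∀ b x → b * - x ≡ - b * x
  mirror = solve-∀

sat-reflect⁻ : ∀ {m} x (y : Vec ℤ m) β → Sat (x ∷ y) (reflect β) → Sat (- x ∷ y) β
sat-reflect⁻ x y (atom κ (b ∷ a) r) = subst (Satisfies κ) (cong (λ z → z + eval a y + r) (mirror b x))
  where
  mirror : ∀ b x → - b * x ≡ b * - x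
  mirror = solve-∀

-- Splitting on the sign of the eliminated variable supplies a lower bound for it, so only the
-- lower-bound case of Cooper's method is needed.
solvable-split : ∀ {m} (cs : List (Atom (suc m))) →
  Solvable cs ⇔ (Solvable (0≤head ∷ cs) ⊎ Solvable (0≤head ∷ List.map reflect cs))
solvable-split cs = mk⇔ split join
  where
  split : Solvable cs → Solvable (0≤head ∷ cs) ⊎ Solvable (0≤head ∷ List.map reflect cs)
  split (x ∷ y , sats) with 0ℤ ℤ.≤? x
  ... | yes 0≤x = inj₁ (x ∷ y , subst (0ℤ ≤_) (sym (value-0≤head x y)) 0≤x ∷ sats)
  ... | no 0≰x =
    inj₂ (- x ∷ y , subst (0ℤ ≤_) (sym (value-0≤head (- x) y)) 0≤-x
                    ∷ All.map⁺ (All.map (λ {β} → mirrored β) sats))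
    where
    0≤-x : 0ℤ ≤ - x
    0≤-x = ℤP.neg-mono-≤ (ℤP.<⇒≤ (ℤP.≰⇒> 0≰x))
    mirrored : ∀ β → Sat (x ∷ y) β → Sat (- x ∷ y) (reflect β)
    mirrored β s = sat-reflect⁺ (- x) y β (subst (λ z → Sat (z ∷ y) β) (sym (ℤP.neg-involutive x)) s)
  join : Solvable (0≤head ∷ cs) ⊎ Solvable (0≤head ∷ List.map reflect cs) → Solvable cs
  join (inj₁ (x , _ ∷ sats)) = x , sats
  join (inj₂ (x ∷ y , _ ∷ sats)) = - x ∷ y , All.map (λ {β} → sat-reflect⁻ x y β) (All.map⁻ sats)

-- (1 + k) (1 + d) = 1 + (d + k (1 + d))
scale : ℕ → Kind → Kind
scale k ≥0 = ≥0
scale k [1+ d ]∣ = [1+ d ℕ.+ k ℕ.* suc d ]∣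

satisfies-scale : ∀ k κ v → Satisfies κ v ⇔ Satisfies (scale k κ) (+[1+ k ] * v)
satisfies-scale k ≥0 v = mk⇔
  (λ 0≤v → subst (_≤ +[1+ k ] * v) (ℤP.*-zeroʳ +[1+ k ]) (ℤP.*-monoˡ-≤-nonNeg +[1+ k ] 0≤v))
  (λ 0≤kv → ℤP.*-cancelˡ-≤-pos 0ℤ v +[1+ k ]
              (subst (_≤ +[1+ k ] * v) (sym (ℤP.*-zeroʳ +[1+ k ])) 0≤kv))
satisfies-scale k [1+ d ]∣ v = mk⇔
  (λ d∣v → subst (_∣ +[1+ k ] * v) (sym (ℤP.pos-* (suc k) (suc d))) (Div.*-monoʳ-∣ +[1+ k ] d∣v))
  (λ kd∣kv → Div.*-cancelˡ-∣ +[1+ k ] (subst (_∣ +[1+ k ] * v) (ℤP.pos-* (suc k) (suc d)) kd∣kv))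

-- Multiplying b x + bs·y + s by 1 + k and replacing (1 + k) x by u − a·y − r eliminates x.
substitute : ∀ {m} → ℕ → Vec ℤ m → ℤ → ℤ → Atom (suc m) → Atom m
substitute k a r u (atom κ (b ∷ bs) s) =
  atom (scale k κ) (lincomb +[1+ k ] (- b) bs a) (+[1+ k ] * s - b * r + b * u)

-- u − r − a·y = (1 + k) x for an integer x.
integrality : ∀ {m} → ℕ → Vec ℤ m → ℤ → ℤ → Atom m
integrality k a r u = atom [1+ k ]∣ (negate a) (u - r)

eliminate : ∀ {m} → ℕ → Vec ℤ m → ℤ → ℤ → List (Atom (suc m)) → List (Atom m)
eliminate k a r u cs = integrality k a r u ∷ List.map (substitute k a r u) cs

module _ {m} (k : ℕ) (a : Vec ℤ m) (r : ℤ) where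

  value-substitute : ∀ x y β →
    value y (substitute k a r (value (x ∷ y) (lowerBound k a r)) β) ≡ +[1+ k ] * value (x ∷ y) β
  value-substitute x y (atom κ (b ∷ bs) s) = begin
    eval (lincomb K (- b) bs a) y + (K * s - b * r + b * (K * x + eval a y + r))
      ≡⟨ cong (λ e → e + (K * s - b * r + b * (K * x + eval a y + r))) (eval-lincomb K (- b) bs a y) ⟩
    K * eval bs y + - b * eval a y + (K * s - b * r + b * (K * x + eval a y + r))
      ≡⟨ cancel K b x (eval a y) (eval bs y) r s ⟩
    K * (b * x + eval bs y + s) ∎
    where
    open ≡-Reasoning
    K = +[1+ k ]
    cancel : ∀ K b x A B r s → K * B + - b * A + (K * s - b * r + b * (K * x + A + r)) ≡ K * (b * x + B + s)
    cancel = solve-∀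

  sat-substitute : ∀ x y β →
    Sat y (substitute k a r (value (x ∷ y) (lowerBound k a r)) β) ⇔ Sat (x ∷ y) β
  sat-substitute x y β@(atom κ (_ ∷ _) _) =
    subst (λ v → Satisfies (scale k κ) v ⇔ Satisfies κ (value (x ∷ y) β)) (sym (value-substitute x y β))
      (⇔.sym (satisfies-scale k κ (value (x ∷ y) β)))

  integrality-sound : ∀ {u} y → Sat y (integrality k a r u) →
    ∃ λ x → value (x ∷ y) (lowerBound k a r) ≡ u
  integrality-sound {u} y (divides x eq) = x , (begin
    +[1+ k ] * x + eval a y + r                 ≡⟨ cong (λ z → z + eval a y + r) (ℤP.*-comm +[1+ k ] x) ⟩
    x * +[1+ k ] + eval a y + r                 ≡⟨ cong (λ z → z + eval a y + r) (sym eq) ⟩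
    eval (negate a) y + (u - r) + eval a y + r
      ≡⟨ cong (λ z → z + (u - r) + eval a y + r) (eval-negate a y) ⟩
    - eval a y + (u - r) + eval a y + r         ≡⟨ cancel (eval a y) u r ⟩
    u                                           ∎)
    where
    open ≡-Reasoning
    cancel : ∀ A u r → - A + (u - r) + A + r ≡ u
    cancel = solve-∀

  integrality-complete : ∀ x y → Sat y (integrality k a r (value (x ∷ y) (lowerBound k a r)))
  integrality-complete x y = divides x (begin
    eval (negate a) y + (K * x + eval a y + r - r)
      ≡⟨ cong (λ z → z + (K * x + eval a y + r - r)) (eval-negate a y) ⟩
    - eval a y + (K * x + eval a y + r - r)        ≡⟨ cancel K x (eval a y) r ⟩
    x * K                                          ∎)
    where
    open ≡-Reasoning
    K = +[1+ k ]
    cancel : ∀ K x A r → - A + (K * x + A + r - r) ≡ x * K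
    cancel = solve-∀

  eliminate-sound : ∀ {u cs} y → All (Sat y) (eliminate k a r u cs) → Solvable cs
  eliminate-sound {u} y (integral ∷ sats) with integrality-sound {u} y integral
  ... | x , refl = x ∷ y , All.map (λ {β} → to (sat-substitute x y β)) (All.map⁻ sats)

  eliminate-complete : ∀ {cs} x y → All (Sat (x ∷ y)) cs →
    All (Sat y) (eliminate k a r (value (x ∷ y) (lowerBound k a r)) cs)
  eliminate-complete x y sats =
    integrality-complete x y ∷ All.map⁺ (All.map (λ {β} → from (sat-substitute x y β)) sats)

lowerBoundOf : ∀ {m} → Atom (suc m) → Maybe (ℕ × Vec ℤ m × ℤ)
lowerBoundOf (atom ≥0 (+[1+ k ] ∷ a) r) = just (k , a , r)
lowerBoundOf _ = nothing

lowerBounds : ∀ {m} → List (Atom (suc m)) → List (ℕ × Vec ℤ m × ℤ)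
lowerBounds = mapMaybe lowerBoundOf

∈-lowerBounds : ∀ {m k a r} {cs : List (Atom (suc m))} →
  lowerBound k a r ∈ cs → (k , a , r) ∈ lowerBounds cs
∈-lowerBounds {cs = cs} β∈cs =
  Any.mapMaybe⁺ lowerBoundOf cs (Any.map⁺ (Any.map (λ { refl → Maybe.just refl }) β∈cs))

TestPoint : ∀ {m} → List (Atom (suc m)) → ℕ × Vec ℤ m × ℤ → Set
TestPoint cs (k , a , r) = ∃ λ (u : Fin (suc k ℕ.* period cs)) → Solvable (eliminate k a r (+ toℕ u) cs)

testPoint-sound : ∀ {m} {cs : List (Atom (suc m))} {bounds} → Any (TestPoint cs) bounds → Solvable cs
testPoint-sound testPoints with Any.satisfied testPoints
... | (k , a , r) , _ , y , sats = eliminate-sound k a r y sats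

-- Moving a solution down by the period δ keeps every atom satisfied until some lower bound
-- (1 + k) x + a·y + r ≥ 0 becomes small, i.e. takes a value u < (1 + k) δ; x is then recovered from u.
module Descent {m} (cs : List (Atom (suc m))) (y : Vec ℤ m) where

  δ : ℕ
  δ = period cs

  instance
    δ≢0 : NonZero δ
    δ≢0 = period≢0 cs

  Small : ℤ → Atom (suc m) → Set
  Small x β@(atom ≥0 (b ∷ _) _) = value (x ∷ y) β < b * + δ
  Small x (atom [1+ _ ]∣ _ _) = ⊥

  small? : ∀ x β → Dec (Small x β)
  small? x β@(atom ≥0 (b ∷ _) _) = value (x ∷ y) β ℤ.<? b * + δ
  small? x (atom [1+ _ ]∣ _ _) = no λ ()

  sat-shift : ∀ {x} β → modulus (kind β) ∣ℕ δ → Sat (x ∷ y) β → ¬ Small x β →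
    Sat ((x - + δ) ∷ y) β
  sat-shift {x} (atom ≥0 (b ∷ a) r) _ _ large =
    subst (0ℤ ≤_) (sym (value-shift x (+ δ) y ≥0 b a r)) (ℤP.i≤j⇒0≤j-i (ℤP.≮⇒≥ large))
  sat-shift {x} (atom [1+ d ]∣ (b ∷ a) r) d∣δ d∣v _ =
    subst (+ suc d ∣_) (sym (value-shift x (+ δ) y [1+ d ]∣ b a r))
      (Div.∣m∣n⇒∣m-n d∣v (Div.∣n⇒∣m*n b (Div.∣ᵤ⇒∣ d∣δ)))

  small⇒lowerBound : ∀ {x} β → Sat (x ∷ y) β → Small x β →
    ∃₂ λ k a → ∃ λ r → β ≡ lowerBound k a r × value (x ∷ y) β < + (suc k ℕ.* δ)
  small⇒lowerBound (atom ≥0 (+[1+ k ] ∷ a) r) _ small =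
    k , a , r , refl , subst (_ <_) (sym (ℤP.pos-* (suc k) δ)) small
  small⇒lowerBound (atom ≥0 (+0 ∷ a) r) 0≤v small = ⊥-elim (ℤP.≤⇒≯ 0≤v small)
  small⇒lowerBound (atom ≥0 (-[1+ k ] ∷ a) r) 0≤v small =
    ⊥-elim (ℤP.≤⇒≯ 0≤v (ℤP.<-≤-trans small (ℤP.*-monoʳ-≤-nonNeg (+ δ) (-≤+ {k} {0}))))

  testPoint : ∀ {x k a r} → All (Sat (x ∷ y)) cs → 0ℤ ≤ value (x ∷ y) (lowerBound k a r) →
    value (x ∷ y) (lowerBound k a r) < + (suc k ℕ.* δ) → TestPoint cs (k , a , r)
  testPoint {x} {k} {a} {r} sats 0≤v v<kδ = fromℕ< ∣v∣<kδ , y ,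
    subst (λ u → All (Sat y) (eliminate k a r u cs)) v≡u (eliminate-complete k a r x y sats)
    where
    v = value (x ∷ y) (lowerBound k a r)
    ∣v∣<kδ : ∣ v ∣ ℕ.< suc k ℕ.* δ
    ∣v∣<kδ = ℤP.drop‿+<+ (subst (_< _) (sym (ℤP.0≤i⇒+∣i∣≡i 0≤v)) v<kδ)
    v≡u : v ≡ + toℕ (fromℕ< ∣v∣<kδ)
    v≡u = trans (sym (ℤP.0≤i⇒+∣i∣≡i 0≤v)) (cong +_ (sym (FinP.toℕ-fromℕ< ∣v∣<kδ)))

  module _ {k₀ a₀ r₀} (β₀∈cs : lowerBound k₀ a₀ r₀ ∈ cs) where

    descend : ∀ {n} → Acc ℕ._<_ n → ∀ x → value (x ∷ y) (lowerBound k₀ a₀ r₀) ≡ + n →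
      All (Sat (x ∷ y)) cs → Any (TestPoint cs) (lowerBounds cs)
    descend (acc smaller) x v≡n sats with Any.any? (small? x) cs
    ... | yes someSmall with find someSmall
    ...   | β , β∈cs , small with small⇒lowerBound β (All.lookup sats β∈cs) small
    ...     | k , a , r , refl , v<kδ =
      lose (∈-lowerBounds β∈cs) (testPoint sats (All.lookup sats β∈cs) v<kδ)
    descend (acc smaller) x v≡n sats | no noneSmall =
      descend (smaller n′<n) (x - + δ) (sym (ℤP.0≤i⇒+∣i∣≡i 0≤v′)) sats′
      where
      sats′ : All (Sat ((x - + δ) ∷ y)) cs
      sats′ = All.tabulate λ β∈cs →
        sat-shift _ (modulus∣period β∈cs) (All.lookup sats β∈cs)
          (All.lookup (All.¬Any⇒All¬ cs noneSmall) β∈cs)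
      v′ = value ((x - + δ) ∷ y) (lowerBound k₀ a₀ r₀)
      0≤v′ : 0ℤ ≤ v′
      0≤v′ = All.lookup sats′ β₀∈cs
      0<k₀δ : 0ℤ < +[1+ k₀ ] * + δ
      0<k₀δ = subst (0ℤ <_) (ℤP.pos-* (suc k₀) δ)
        (ℤ.+<+ (ℕ.>-nonZero⁻¹ (suc k₀ ℕ.* δ) {{ℕP.m*n≢0 (suc k₀) δ}}))
      v′<v : v′ < + _
      v′<v = subst₂ _<_ (sym (value-shift x (+ δ) y ≥0 +[1+ k₀ ] a₀ r₀)) v≡n (i-j<i _ 0<k₀δ)
      n′<n = ℤP.drop‿+<+ (subst (_< _) (sym (ℤP.0≤i⇒+∣i∣≡i 0≤v′)) v′<v)

testPoint-complete : ∀ {m k a r} {cs : List (Atom (suc m))} → lowerBound k a r ∈ cs → Solvable cs →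
  Any (TestPoint cs) (lowerBounds cs)
testPoint-complete β₀∈cs (x ∷ y , sats) =
  descend β₀∈cs (<-wellFounded _) x (sym (ℤP.0≤i⇒+∣i∣≡i (All.lookup sats β₀∈cs))) sats
  where open Descent _ y

solvable? : ∀ {m} (cs : List (Atom m)) → Dec (Solvable cs)
solvable? {zero} cs = Dec.map (mk⇔ ([] ,_) λ { ([] , sats) → sats }) (All.all? (sat? []) cs)
solvable? {suc m} cs =
  Dec.map (⇔.sym (solvable-split cs)) (headBounded? cs ⊎-dec headBounded? (List.map reflect cs))
  where
  testPoint? : ∀ ds → Decidable (TestPoint ds)
  testPoint? ds (k , a , r) = FinP.any? λ u → solvable? (eliminate k a r (+ toℕ u) ds)
  headBounded? : ∀ ds → Dec (Solvable (0≤head ∷ ds))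
  headBounded? ds = Dec.map (mk⇔ testPoint-sound (testPoint-complete (here refl)))
    (Any.any? (testPoint? (0≤head ∷ ds)) (lowerBounds (0≤head ∷ ds)))

increasing⇒¬boundedAbove : ∀ {s} → Increasing s → ¬ BoundedAbove s
increasing⇒¬boundedAbove {s} increasing (b , s<b) = ℤP.<-irrefl refl (ℤP.<-≤-trans (s<b k) b≤sₖ)
  where
  open ℤP.≤-Reasoning
  grows : ∀ k → s 0 + + k ≤ s k
  grows zero = ℤP.≤-reflexive (ℤP.+-identityʳ (s 0))
  grows (suc k) = begin
    s 0 + (1ℤ + + k)    ≡⟨ shift (s 0) (+ k) ⟩
    1ℤ + (s 0 + + k)    ≤⟨ ℤP.i<j⇒suc[i]≤j (ℤP.≤-<-trans (grows k) (increasing k)) ⟩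
    s (suc k)           ∎
    where
    shift : ∀ a k → a + (1ℤ + k) ≡ 1ℤ + (a + k)
    shift = solve-∀
  k = ∣ b - s 0 ∣
  b≤sₖ : b ≤ s k
  b≤sₖ = begin
    b                  ≡⟨ cancel b (s 0) ⟩
    s 0 + (b - s 0)    ≤⟨ ℤP.+-monoʳ-≤ (s 0) (i≤+∣i∣ (b - s 0)) ⟩
    s 0 + + k          ≤⟨ grows k ⟩
    s k                ∎
    where
    cancel : ∀ b a → b ≡ a + (b - a)
    cancel = solve-∀

decreasing⇒¬boundedBelow : ∀ {s} → Decreasing s → ¬ BoundedBelow s
decreasing⇒¬boundedBelow {s} decreasing (b , b<s) =
  increasing⇒¬boundedAbove {λ k → - s k} (ℤP.neg-mono-< ∘ decreasing) (- b , ℤP.neg-mono-< ∘ b<s)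

flat⇒constant : ∀ {s} → Flat s → ∀ k → s k ≡ s 0
flat⇒constant constant zero = refl
flat⇒constant constant (suc k) = trans (sym (constant k)) (flat⇒constant constant k)

Sign : Mode → ℤ → Set
Sign unboundedIncreasing d = 0ℤ < d
Sign unboundedDecreasing d = d < 0ℤ
Sign flat d = d ≡ 0ℤ
Sign boundedIncreasing _ = ⊥
Sign boundedDecreasing _ = ⊥

hasMode⇒sign : ∀ {s} md → HasMode s md → Sign md (s 1 - s 0)
hasMode⇒sign unboundedIncreasing (increasing , _) = 0<j-i (increasing 0)
hasMode⇒sign unboundedDecreasing (decreasing , _) = i-j<0 (decreasing 0)
hasMode⇒sign flat constant = ℤP.i≡j⇒i-j≡0 (sym (constant 0))
hasMode⇒sign boundedIncreasing (increasing , bounded) = increasing⇒¬boundedAbove increasing bounded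
hasMode⇒sign boundedDecreasing (decreasing , bounded) = decreasing⇒¬boundedBelow decreasing bounded

progression-hasMode : ∀ {h : ℕ → ℕ} → (∀ k → h k ℕ.< h (suc k)) →
  ∀ {s s₀ d} → (∀ k → s k ≡ s₀ + + h k * d) → ∀ md → Sign md d → HasMode s md
progression-hasMode {h} h-increasing {s} {s₀} {d} s≡ = hasMode
  where
  along : ∀ {R : ℤ → ℤ → Set} → (∀ k → R (s₀ + + h k * d) (s₀ + + h (suc k) * d)) →
    ∀ k → R (s k) (s (suc k))
  along {R} r k = subst₂ R (sym (s≡ k)) (sym (s≡ (suc k))) (r k)
  hasMode : ∀ md → Sign md d → HasMode s md
  hasMode unboundedIncreasing 0<d = increasing , increasing⇒¬boundedAbove increasing
    where
    increasing : Increasing s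
    increasing = along {_<_} λ k →
      ℤP.+-monoʳ-< s₀ (ℤP.*-monoʳ-<-pos d {{ℤ.positive 0<d}} (ℤ.+<+ (h-increasing k)))
  hasMode unboundedDecreasing d<0 = decreasing , decreasing⇒¬boundedBelow decreasing
    where
    decreasing : Decreasing s
    decreasing = along {λ a b → b < a} λ k →
      ℤP.+-monoʳ-< s₀ (ℤP.*-monoʳ-<-neg d {{ℤ.negative d<0}} (ℤ.+<+ (h-increasing k)))
  hasMode flat refl = along {_≡_} λ k →
    cong (_+_ s₀) (trans (ℤP.*-zeroʳ (+ h k)) (sym (ℤP.*-zeroʳ (+ h (suc k)))))

-- Seeds: the first two points of a chain

record Seed {n l} (T : System n l) (M : ModeVector n l) : Set where
  field
    start next : Point n
    holds : Holds T start next
    varSign : ∀ i → Sign (varMode M i) (lookup next i - lookup start i)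
    PSign : ∀ j → Sign (PMode M j) (eval (P (T j)) next - eval (P (T j)) start)
    QSign : ∀ j → Sign (QMode M j) (eval (Q (T j)) next - eval (Q (T j)) start)

chain⇒seed : ∀ {n l} {T : System n l} {M : ModeVector n l} → HasMonotonicStrongChain T M → Seed T M
chain⇒seed {M = M} (V , step , _ , varModes , PModes , QModes) = record
  { start = V 0
  ; next = V 1
  ; holds = step 0
  ; varSign = λ i → hasMode⇒sign (varMode M i) (varModes i)
  ; PSign = λ j → hasMode⇒sign (PMode M j) (PModes j)
  ; QSign = λ j → hasMode⇒sign (QMode M j) (QModes j)
  }

atLeast : ∀ {m} → Vec ℤ m → ℤ → Atom m
atLeast a c = atom ≥0 a (- c)

sat-atLeast : ∀ {m} (x : Vec ℤ m) a c → Sat x (atLeast a c) ⇔ c ≤ eval a x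
sat-atLeast _ _ _ = mk⇔ ℤP.0≤i-j⇒j≤i ℤP.i≤j⇒0≤j-i

sat-atLeast-negate : ∀ {m} (x : Vec ℤ m) a c → Sat x (atLeast (negate a) c) ⇔ c ≤ - eval a x
sat-atLeast-negate x a c =
  subst (λ v → Sat x (atLeast (negate a) c) ⇔ c ≤ v) (eval-negate a x) (sat-atLeast x (negate a) c)

unsatisfiable : ∀ {m} → Atom m
unsatisfiable = atLeast zeros 1ℤ

¬sat-unsatisfiable : ∀ {m} (x : Vec ℤ m) → ¬ Sat x unsatisfiable
¬sat-unsatisfiable x s with subst (1ℤ ≤_) (eval-zeros x) (to (sat-atLeast x zeros 1ℤ) s)
... | +≤+ ()

signAtoms : ∀ {m} → Mode → Vec ℤ m → List (Atom m)
signAtoms unboundedIncreasing g = atLeast g 1ℤ ∷ []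
signAtoms unboundedDecreasing g = atLeast (negate g) 1ℤ ∷ []
signAtoms flat g = atLeast g 0ℤ ∷ atLeast (negate g) 0ℤ ∷ []
signAtoms boundedIncreasing _ = unsatisfiable ∷ []
signAtoms boundedDecreasing _ = unsatisfiable ∷ []

sat-signAtoms : ∀ {m} md (g x : Vec ℤ m) → All (Sat x) (signAtoms md g) ⇔ Sign md (eval g x)
sat-signAtoms unboundedIncreasing g x = mk⇔
  (λ { (1≤v ∷ []) → ℤP.suc[i]≤j⇒i<j (to (sat-atLeast x g 1ℤ) 1≤v) })
  (λ 0<v → from (sat-atLeast x g 1ℤ) (ℤP.i<j⇒suc[i]≤j 0<v) ∷ [])
sat-signAtoms unboundedDecreasing g x = mk⇔
  (λ { (1≤-v ∷ []) → ℤP.neg-cancel-< (ℤP.suc[i]≤j⇒i<j (to (sat-atLeast-negate x g 1ℤ) 1≤-v)) })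
  (λ v<0 → from (sat-atLeast-negate x g 1ℤ) (ℤP.i<j⇒suc[i]≤j (ℤP.neg-mono-< v<0)) ∷ [])
sat-signAtoms flat g x = mk⇔
  (λ { (0≤v ∷ 0≤-v ∷ []) →
       ℤP.≤-antisym (ℤP.neg-cancel-≤ (to (sat-atLeast-negate x g 0ℤ) 0≤-v))
                    (to (sat-atLeast x g 0ℤ) 0≤v) })
  (λ v≡0 → from (sat-atLeast x g 0ℤ) (ℤP.≤-reflexive (sym v≡0))
         ∷ from (sat-atLeast-negate x g 0ℤ) (ℤP.≤-reflexive (sym (cong -_ v≡0))) ∷ [])
sat-signAtoms boundedIncreasing g x = mk⇔ (λ { (s ∷ []) → ¬sat-unsatisfiable x s }) λ ()
sat-signAtoms boundedDecreasing g x = mk⇔ (λ { (s ∷ []) → ¬sat-unsatisfiable x s }) λ ()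

difference : ∀ {n} → LinComb n → Vec ℤ (n ℕ.+ n)
difference f = negate f ++ f

eval-difference : ∀ {n} (f u v : Vec ℤ n) → eval (difference f) (u ++ v) ≡ eval f v - eval f u
eval-difference f u v = begin
  eval (negate f ++ f) (u ++ v)   ≡⟨ eval-++ (negate f) f u v ⟩
  eval (negate f) u + eval f v    ≡⟨ cong (λ e → e + eval f v) (eval-negate f u) ⟩
  - eval f u + eval f v           ≡⟨ ℤP.+-comm (- eval f u) (eval f v) ⟩
  eval f v - eval f u             ∎
  where open ≡-Reasoning

sat-differenceAtoms : ∀ {n} md (f u v : Vec ℤ n) →
  All (Sat (u ++ v)) (signAtoms md (difference f)) ⇔ Sign md (eval f v - eval f u)
sat-differenceAtoms md f u v =
  subst (λ d → All (Sat (u ++ v)) (signAtoms md (difference f)) ⇔ Sign md d) (eval-difference f u v)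
    (sat-signAtoms md (difference f) (u ++ v))

sat-unitDifferenceAtoms : ∀ {n} md (i : Fin n) u v →
  All (Sat (u ++ v)) (signAtoms md (difference (unit i))) ⇔ Sign md (lookup v i - lookup u i)
sat-unitDifferenceAtoms md i u v =
  subst (λ d → All (Sat (u ++ v)) (signAtoms md (difference (unit i))) ⇔ Sign md d)
    (cong₂ _-_ (eval-unit i v) (eval-unit i u)) (sat-differenceAtoms md (unit i) u v)

holdAtom : ∀ {n} → Ineq n → Atom (n ℕ.+ n)
holdAtom I = atLeast (P I ++ Q I) (1ℤ + c I)

sat-holdAtom : ∀ {n} (I : Ineq n) u v → Sat (u ++ v) (holdAtom I) ⇔ eval (P I) u + eval (Q I) v > c I
sat-holdAtom I u v =
  subst (λ w → Sat (u ++ v) (holdAtom I) ⇔ c I < w) (eval-++ (P I) (Q I) u v)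
    (⇔.trans (sat-atLeast (u ++ v) (P I ++ Q I) (1ℤ + c I)) (mk⇔ ℤP.suc[i]≤j⇒i<j ℤP.i<j⇒suc[i]≤j))

seedAtoms : ∀ {n l} → System n l → ModeVector n l → List (Atom (n ℕ.+ n))
seedAtoms T M =
  List.tabulate (holdAtom ∘ T) List.++
  List.concat (List.tabulate λ i → signAtoms (varMode M i) (difference (unit i))) List.++
  List.concat (List.tabulate λ j → signAtoms (PMode M j) (difference (P (T j)))) List.++
  List.concat (List.tabulate λ j → signAtoms (QMode M j) (difference (Q (T j))))

all-concat-tabulate : ∀ {A : Set} {Pr : A → Set} {k} (f : Fin k → List A) →
  All Pr (List.concat (List.tabulate f)) ⇔ (∀ i → All Pr (f i))
all-concat-tabulate f = mk⇔ (All.tabulate⁻ ∘ All.concat⁻) (All.concat⁺ ∘ All.tabulate⁺)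

seed⇔solvable : ∀ {n l} (T : System n l) (M : ModeVector n l) → Seed T M ⇔ Solvable (seedAtoms T M)
seed⇔solvable {n} T M = mk⇔ encode decode
  where
  encode : Seed T M → Solvable (seedAtoms T M)
  encode seed = start ++ next , All.++⁺ holdAtoms (All.++⁺ varAtoms (All.++⁺ PAtoms QAtoms))
    where
    open Seed seed
    holdAtoms = All.tabulate⁺ λ j → from (sat-holdAtom (T j) start next) (holds j)
    varAtoms = from (all-concat-tabulate _) λ i →
      from (sat-unitDifferenceAtoms (varMode M i) i start next) (varSign i)
    PAtoms = from (all-concat-tabulate _) λ j →
      from (sat-differenceAtoms (PMode M j) (P (T j)) start next) (PSign j)
    QAtoms = from (all-concat-tabulate _) λ j →
      from (sat-differenceAtoms (QMode M j) (Q (T j)) start next) (QSign j)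
  decode : Solvable (seedAtoms T M) → Seed T M
  decode (x , sats) with Vec.splitAt n x
  ... | u , v , refl =
    let holdAtoms , rest₁ = All.++⁻ _ sats
        varAtoms , rest₂ = All.++⁻ _ rest₁
        PAtoms , QAtoms = All.++⁻ _ rest₂
    in record
      { start = u
      ; next = v
      ; holds = λ j → to (sat-holdAtom (T j) u v) (All.tabulate⁻ holdAtoms j)
      ; varSign = λ i → to (sat-unitDifferenceAtoms (varMode M i) i u v) (to (all-concat-tabulate _) varAtoms i)
      ; PSign = λ j → to (sat-differenceAtoms (PMode M j) (P (T j)) u v) (to (all-concat-tabulate _) PAtoms j)
      ; QSign = λ j → to (sat-differenceAtoms (QMode M j) (Q (T j)) u v) (to (all-concat-tabulate _) QAtoms j)
      }

-- From a seed to a chain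

compatible : Mode → Mode → Bool
compatible _ unboundedDecreasing = false
compatible unboundedDecreasing flat = false
compatible _ _ = true

strong⇒compatible : ∀ {p q : ℕ → ℤ} {c} pm qm → HasMode p pm → HasMode q qm →
  (∀ k₁ k₂ → k₁ ℕ.< k₂ → c < p k₁ + q k₂) → compatible pm qm ≡ true
strong⇒compatible {p} {q} {c} pm unboundedDecreasing _ (decreasing , _) strong =
  ⊥-elim (decreasing⇒¬boundedBelow (decreasing ∘ suc)
    (c - p 0 , λ k → i<j+k⇒i-j<k (p 0) (strong 0 (suc k) z<s)))
strong⇒compatible {p} {q} {c} unboundedDecreasing flat (decreasing , _) constant strong =
  ⊥-elim (decreasing⇒¬boundedBelow decreasing (c - q 0 , λ k → i<j+k⇒i-j<k (q 0) (c<q₀+p k)))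
  where
  c<q₀+p : ∀ k → c < q 0 + p k
  c<q₀+p k = subst (c <_) (trans (cong (_+_ (p k)) (flat⇒constant constant (suc k))) (ℤP.+-comm (p k) (q 0)))
    (strong k (suc k) (ℕP.n<1+n k))
strong⇒compatible _ unboundedIncreasing _ _ _ = refl
strong⇒compatible unboundedIncreasing flat _ _ _ = refl
strong⇒compatible flat flat _ _ _ = refl
strong⇒compatible boundedIncreasing flat _ _ _ = refl
strong⇒compatible boundedDecreasing flat _ _ _ = refl
strong⇒compatible _ boundedIncreasing _ _ _ = refl
strong⇒compatible _ boundedDecreasing _ _ _ = refl

rising-dominates : ∀ {pd qd} a b → 0ℤ < qd → ∣ pd ∣ ℕ.* a ℕ.< b → qd ≤ + a * pd + + b * qd
rising-dominates {pd} {qd} a (suc b) 0<qd bound = begin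
  qd                           ≡⟨ balance qd A ⟩
  - A + (qd + A)               ≤⟨ ℤP.+-mono-≤ -A≤a*pd (ℤP.+-monoʳ-≤ qd A≤b*qd) ⟩
  + a * pd + (qd + + b * qd)   ≡⟨ collect (+ a * pd) qd (+ b) ⟩
  + a * pd + + suc b * qd      ∎
  where
  open ℤP.≤-Reasoning
  A = + (∣ pd ∣ ℕ.* a)
  balance : ∀ q A → q ≡ - A + (q + A)
  balance = solve-∀
  collect : ∀ x q b → x + (q + b * q) ≡ x + (1ℤ + b) * q
  collect = solve-∀
  -A≤a*pd : - A ≤ + a * pd
  -A≤a*pd = begin
    - + (∣ pd ∣ ℕ.* a)
      ≡⟨ cong -_ (trans (ℤP.pos-* ∣ pd ∣ a) (ℤP.*-comm (+ ∣ pd ∣) (+ a))) ⟩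
    - (+ a * + ∣ pd ∣)     ≡⟨ ℤP.neg-distribʳ-* (+ a) (+ ∣ pd ∣) ⟩
    + a * - + ∣ pd ∣       ≤⟨ ℤP.*-monoˡ-≤-nonNeg (+ a) (-∣i∣≤i pd) ⟩
    + a * pd              ∎
  A≤b*qd : A ≤ + b * qd
  A≤b*qd = begin
    A            ≤⟨ +≤+ (ℕ.s≤s⁻¹ bound) ⟩
    + b          ≡⟨ ℤP.*-identityʳ (+ b) ⟨
    + b * 1ℤ     ≤⟨ ℤP.*-monoˡ-≤-nonNeg (+ b) (ℤP.i<j⇒suc[i]≤j 0<qd) ⟩
    + b * qd     ∎

flat-dominates : ∀ {pd} a b → 0ℤ ≤ pd → 0ℤ ≤ + a * pd + + b * 0ℤ
flat-dominates {pd} a b 0≤pd = begin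
  0ℤ                     ≡⟨ ℤP.*-zeroʳ (+ a) ⟨
  + a * 0ℤ               ≤⟨ ℤP.*-monoˡ-≤-nonNeg (+ a) 0≤pd ⟩
  + a * pd               ≡⟨ ℤP.+-identityʳ (+ a * pd) ⟨
  + a * pd + 0ℤ          ≡⟨ cong (_+_ (+ a * pd)) (ℤP.*-zeroʳ (+ b)) ⟨
  + a * pd + + b * 0ℤ    ∎
  where open ℤP.≤-Reasoning

compatible⇒dominates : ∀ pm qm {pd qd} a b → compatible pm qm ≡ true → Sign pm pd → Sign qm qd →
  ∣ pd ∣ ℕ.* a ℕ.< b → qd ≤ + a * pd + + b * qd
compatible⇒dominates _ unboundedIncreasing a b _ _ 0<qd bound = rising-dominates a b 0<qd bound
compatible⇒dominates unboundedIncreasing flat a b _ 0<pd refl _ = flat-dominates a b (ℤP.<⇒≤ 0<pd)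
compatible⇒dominates flat flat a b _ refl refl _ = flat-dominates a b ℤP.≤-refl

holds-persists : ∀ {c pd} p₀ q₀ q₁ a b → c < p₀ + q₁ → q₁ - q₀ ≤ a * pd + b * (q₁ - q₀) →
  c < (p₀ + a * pd) + (q₀ + b * (q₁ - q₀))
holds-persists {c} {pd} p₀ q₀ q₁ a b c<p₀+q₁ dominated = ℤP.<-≤-trans c<p₀+q₁ (begin
  p₀ + q₁                                   ≡⟨ split p₀ q₀ q₁ ⟩
  p₀ + q₀ + (q₁ - q₀)                       ≤⟨ ℤP.+-monoʳ-≤ (p₀ + q₀) dominated ⟩
  p₀ + q₀ + (a * pd + b * (q₁ - q₀))        ≡⟨ regroup p₀ q₀ (a * pd) (b * (q₁ - q₀)) ⟩
  (p₀ + a * pd) + (q₀ + b * (q₁ - q₀))      ∎)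
  where
  open ℤP.≤-Reasoning
  split : ∀ p₀ q₀ q₁ → p₀ + q₁ ≡ p₀ + q₀ + (q₁ - q₀)
  split = solve-∀
  regroup : ∀ p₀ q₀ x y → p₀ + q₀ + (x + y) ≡ (p₀ + x) + (q₀ + y)
  regroup = solve-∀

module FromSeed {n l} {T : System n l} {M : ModeVector n l}
  (compatibility : ∀ j → compatible (PMode M j) (QMode M j) ≡ true) (seed : Seed T M) where

  open Seed seed

  slope : LinComb n → ℤ
  slope f = eval f next - eval f start

  rate : ℕ
  rate = max 0 (List.tabulate λ j → ∣ slope (P (T j)) ∣)

  h : ℕ → ℕ
  h k = (2 ℕ.+ rate) ^ k

  h-increasing : ∀ k → h k ℕ.< h (suc k)
  h-increasing k = ℕP.^-monoʳ-< (2 ℕ.+ rate) (s≤s (s≤s z≤n)) (ℕP.n<1+n k)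

  h-outgrows : ∀ j {k₁ k₂} → k₁ ℕ.< k₂ → ∣ slope (P (T j)) ∣ ℕ.* h k₁ ℕ.< h k₂
  h-outgrows j {k₁} {k₂} k₁<k₂ = begin-strict
    ∣ slope (P (T j)) ∣ ℕ.* h k₁
      ≤⟨ ℕP.*-monoˡ-≤ (h k₁) (All.tabulate⁻ (xs≤max 0 (List.tabulate _)) j) ⟩
    rate ℕ.* h k₁
      <⟨ ℕP.*-monoˡ-< (h k₁) {{ℕP.m^n≢0 (2 ℕ.+ rate) k₁}} (ℕP.m≤n+m (suc rate) 1) ⟩
    h (suc k₁)
      ≤⟨ ℕP.^-monoʳ-≤ (2 ℕ.+ rate) k₁<k₂ ⟩
    h k₂ ∎
    where open ℕP.≤-Reasoning

  chain : Sequence n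
  chain k = interpolate (+ h k) start next

  eval-chain : ∀ f k → eval f (chain k) ≡ eval f start + + h k * slope f
  eval-chain f k = eval-interpolate f start next (+ h k)

  strong : IsStrong T chain
  strong k₁ k₂ k₁<k₂ j =
    subst₂ (λ p q → c (T j) < p + q) (sym (eval-chain (P (T j)) k₁)) (sym (eval-chain (Q (T j)) k₂))
      (holds-persists (eval (P (T j)) start) (eval (Q (T j)) start) (eval (Q (T j)) next)
        (+ h k₁) (+ h k₂) (holds j)
        (compatible⇒dominates (PMode M j) (QMode M j) (h k₁) (h k₂)
          (compatibility j) (PSign j) (QSign j) (h-outgrows j k₁<k₂)))

  progression : ∀ f md → Sign md (slope f) → HasMode (λ k → eval f (chain k)) md
  progression f = progression-hasMode h-increasing {s₀ = eval f start} (eval-chain f)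

  monotonic : IsMonotonic T M chain
  monotonic =
    (λ i → progression-hasMode h-increasing {s₀ = lookup start i} (λ k → lookup-zipWith _ i start next)
             (varMode M i) (varSign i)) ,
    (λ j → progression (P (T j)) (PMode M j) (PSign j)) ,
    (λ j → progression (Q (T j)) (QMode M j) (QSign j))

  hasChain : HasMonotonicStrongChain T M
  hasChain = chain , (λ k → strong k (suc k) (ℕP.n<1+n k)) , strong , monotonic

chain⇔compatible×seed : ∀ {n l} (T : System n l) (M : ModeVector n l) →
  HasMonotonicStrongChain T M ⇔ ((∀ j → compatible (PMode M j) (QMode M j) ≡ true) × Seed T M)
chain⇔compatible×seed T M = mk⇔
  (λ chain@(_ , _ , strong , _ , PModes , QModes) →
     (λ j → strong⇒compatible (PMode M j) (QMode M j) (PModes j) (QModes j)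
              (λ k₁ k₂ k₁<k₂ → strong k₁ k₂ k₁<k₂ j)) ,
     chain⇒seed chain)
  (λ (compatibility , seed) → FromSeed.hasChain compatibility seed)

lemma6 : (n l : ℕ) (T : System n l) (M : ModeVector n l) → Dec (HasMonotonicStrongChain T M)
lemma6 n l T M =
  Dec.map (⇔.sym (chain⇔compatible×seed T M))
    (FinP.all? (λ j → compatible (PMode M j) (QMode M j) Bool.≟ true)
      ×-dec Dec.map (⇔.sym (seed⇔solvable T M)) (solvable? (seedAtoms T M)))
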